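{- Let $G$ be a $C_4$-free Helly graph with diameter $d$ and radius $r$. Let $s$ be an arbitrary vertex, $v$ a vertex at maximum distance from $s$, and $(x,y)$ a diametral pair of $G$. Then $e(v)\ge d-2$. Furthermore, if $e(v)=d-2$, then $e(v)=2r-3=dist(v,x)=dist(v,y)$ and $d=2r-1$. In particular, if $e(v)$ is even, then $e(v)\ge d-1$.
   Context: Graphs are finite, connected, undirected and unweighted, with shortest-path distance $dist$. A graph is Helly if every family of pairwise intersecting balls $N^r[v]=\{u: dist(u,v)\le r\}$ has a nonempty common intersection; it is $C_4$-free if it has no induced 4-cycle. $e(v)=\max_u dist(u,v)$, the radius is $\min_v e(v)$, the diameter is $\max_v e(v)$, and a diametral pair is a pair $(x,y)$ with $dist(x,y)$ equal to the diameter. -}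

module Defs where

open import Data.Nat using (ℕ; zero; suc; _≤_)
open import Data.Fin using (Fin)
open import Data.Empty using (⊥)
open import Data.Product using (Σ; ∃; _×_; _,_)
open import Relation.Nullary using (¬_; Dec)
open import Relation.Binary.PropositionalEquality using (_≡_; _≢_)

record Graph (n : ℕ) : Set₁ where
  field
    Adj     : Fin n → Fin n → Set
    Adj-dec : ∀ u v → Dec (Adj u v)
    Adj-sym : ∀ {u v} → Adj u v → Adj v u
    Adj-irr : ∀ {u} → ¬ Adj u u
open Graph public

module _ {n : ℕ} (G : Graph n) where

  data Walk : Fin n → Fin n → ℕ → Set where
    [] : ∀ {u} → Walk u u zero
    _∷_ : ∀ {u w v k} → Adj G u w → Walk w v k → Walk u v (suc k)

  DistLE : Fin n → Fin n → ℕ → Set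
  DistLE u v k = Σ ℕ λ m → m ≤ k × Walk u v m

  Dist : Fin n → Fin n → ℕ → Set
  Dist u v k = DistLE u v k × (∀ m → DistLE u v m → k ≤ m)

  Connected : Set
  Connected = ∀ u v → ∃ λ k → Walk u v k

  InBall : ℕ → Fin n → Fin n → Set
  InBall r v u = DistLE u v r

  Helly : Set
  Helly = ∀ (m : ℕ) (c : Fin m → Fin n) (ρ : Fin m → ℕ) →
          (∀ i j → ∃ λ u → InBall (ρ i) (c i) u × InBall (ρ j) (c j) u) →
          ∃ λ u → ∀ i → InBall (ρ i) (c i) u

  C4Free : Set
  C4Free = ∀ a b c d → Adj G a b → Adj G b c → Adj G c d → Adj G d a →
           a ≢ c → b ≢ d → ¬ Adj G a c → ¬ Adj G b d → ⊥

  Ecc : Fin n → ℕ → Set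
  Ecc v k = (∀ u → DistLE u v k) × ∃ λ u → Dist u v k

  Radius : ℕ → Set
  Radius r = (∃ λ v → Ecc v r) × (∀ v k → Ecc v k → r ≤ k)

  Diameter : ℕ → Set
  Diameter d = (∃ λ v → Ecc v d) × (∀ v k → Ecc v k → k ≤ d)

module Submission where

-- For a geodesic x—y of length d = t + t', the slice of vertices within t of
-- x and t' of y is a clique: two slice vertices at distance 2 would close an
-- induced C4 with Helly points nearer to x and to y, and larger distances are
-- reduced to 2 by Helly with four balls.  Helly also projects any p within
-- t + β of x and t' + β of y to a slice vertex within β of p.
-- Key lemma: if s is within k of x and y, and v is within t + β of x and
-- t' + β of y with β + 2 ≤ min(t,t'), then projecting s and v onto the clique
-- gives dist(s,v) < k.  So a vertex v farthest from s is not within A of x and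
-- B of y when A, B ≤ d - 2 and B ≤ d - 3 or d is even (choose the split by
-- halving d).  This yields e(v) ≥ d - 2 and, when e(v) = d - 2, that d is odd
-- and both ends of every diametral pair are at distance e(v) from v; with
-- d ≤ 2r ≤ d + 1 (the latter by Helly) odd d forces 2r = d + 1.
-- The file develops: arithmetic of splits, distances, radius bounds, slices,
-- the key lemma, the farthest-vertex consequences, and finally the theorem.

open import Defs
open import Data.Nat using (ℕ; zero; suc; _≤_; _<_; _+_; _*_; _∸_; _⊓_; z≤n; s≤s; _≤?_)
open import Data.Nat.Properties
open import Data.Nat.Divisibility using (_∣_; divides; ∣-refl; ∣m∣n⇒∣m+n)
open import Data.Nat.Tactic.RingSolver using (solve-∀)
open import Data.Fin using (Fin) renaming (zero to fz; suc to fs)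
open import Data.Fin.Properties using (any?; all?; ¬∀⟶∃¬) renaming (_≟_ to _≟F_)
open import Data.Product using (_×_; ∃; _,_; proj₁; proj₂)
open import Data.Sum using (_⊎_; inj₁; inj₂)
open import Data.Empty using (⊥; ⊥-elim)
open import Function using (_∘_; id)
open import Relation.Nullary using (¬_; Dec; yes; no)
open import Relation.Binary.PropositionalEquality
  using (_≡_; _≢_; refl; sym; trans; cong; subst)

halve : ∀ d → ∃ λ h → d ≡ 2 * h ⊎ d ≡ suc (2 * h)
halve zero = 0 , inj₁ refl
halve (suc d) with halve d
... | h , inj₁ refl = h , inj₂ refl
... | h , inj₂ refl = suc h , inj₁ (cong suc (sym (+-suc h (h + 0))))

double : ∀ h → h + h ≡ 2 * h
double h = cong (h +_) (sym (+-identityʳ h))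

odd∤ : ∀ h → ¬ 2 ∣ suc (2 * h)
odd∤ h (divides q eq) = even≢odd q h (trans (*-comm 2 q) (sym eq))

even∣ : ∀ r → 2 ∣ 2 * r
even∣ r = divides r (*-comm 2 r)

ceilHalf : ∀ d → ∃ λ h → d ≤ 2 * h × 2 * h ≤ suc d
ceilHalf d with halve d
... | h , inj₁ refl = h , ≤-refl , n≤1+n _
... | h , inj₂ refl = suc h , ≤-trans (n≤1+n _) (≤-reflexive 2[h+1]) , ≤-reflexive (sym 2[h+1])
  where
  2[h+1] : suc (suc (2 * h)) ≡ 2 * suc h
  2[h+1] = cong suc (sym (+-suc h (h + 0)))

+3⇒+2 : ∀ {a d} → a + 3 ≤ d → a + 2 ≤ d
+3⇒+2 {a} = ≤-trans (+-monoʳ-≤ a (n≤1+n 2))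

cancelAfter : ∀ {a c e} m → e ≡ c + m → a + m ≤ e → a ≤ c
cancelAfter {a} {c} m e≡c+m a+m≤e = +-cancelʳ-≤ m a c (subst (a + m ≤_) e≡c+m a+m≤e)

-- A split of a geodesic of length d into t + t', with slack β, covering
-- distances A (from the t-end) and B (from the t'-end).
record Split (A B d : ℕ) : Set where
  field
    t t' β : ℕ
    t+t'≡d : t + t' ≡ d
    A≤t+β  : A ≤ t + β
    B≤t'+β : B ≤ t' + β
    2+β≤t  : 2 + β ≤ t
    2+β≤t' : 2 + β ≤ t'

-- The hypotheses below force d ≥ 4, so that both halves of d are at least 2.
four≤ : ∀ {A B d} → A + 2 ≤ d → B + 2 ≤ d → d ≤ A + B → 4 ≤ d
four≤ {A} {B} {d} A+2≤d B+2≤d d≤A+B = +-cancelˡ-≤ d 4 d (begin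
  d + 4             ≤⟨ +-monoˡ-≤ 4 d≤A+B ⟩
  A + B + 4         ≡⟨ regroup A B ⟩
  (A + 2) + (B + 2) ≤⟨ +-mono-≤ A+2≤d B+2≤d ⟩
  d + d             ∎)
  where
  open ≤-Reasoning
  regroup : ∀ A B → A + B + 4 ≡ (A + 2) + (B + 2)
  regroup = solve-∀

-- Halve d (β = ⌊d/2⌋ - 2); for odd d the longer half serves the larger distance A.
splitHalves : ∀ {A B d} → (∃ λ h → d ≡ 2 * h ⊎ d ≡ suc (2 * h)) → 4 ≤ d →
              A + 2 ≤ d → B + 2 ≤ d → B + 3 ≤ d ⊎ 2 ∣ d → Split A B d
splitHalves (zero , inj₁ refl) ()
splitHalves (zero , inj₂ refl) (s≤s ())
splitHalves (suc zero , inj₁ refl) (s≤s (s≤s ()))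
splitHalves (suc zero , inj₂ refl) (s≤s (s≤s (s≤s ())))
splitHalves (suc (suc b) , inj₁ refl) _ A+2≤d B+2≤d _ = record
  { t = 2 + b ; t' = 2 + b ; β = b
  ; t+t'≡d = e₁ b
  ; A≤t+β = cancelAfter 2 (e₂ b) A+2≤d
  ; B≤t'+β = cancelAfter 2 (e₂ b) B+2≤d
  ; 2+β≤t = ≤-refl ; 2+β≤t' = ≤-refl }
  where
  e₁ : ∀ b → (2 + b) + (2 + b) ≡ 2 * (2 + b)
  e₁ = solve-∀
  e₂ : ∀ b → 2 * (2 + b) ≡ ((2 + b) + b) + 2
  e₂ = solve-∀
splitHalves (suc (suc b) , inj₂ refl) _ _ _ (inj₂ 2∣d) = ⊥-elim (odd∤ (2 + b) 2∣d)
splitHalves (suc (suc b) , inj₂ refl) _ A+2≤d _ (inj₁ B+3≤d) = record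
  { t = 3 + b ; t' = 2 + b ; β = b
  ; t+t'≡d = o₁ b
  ; A≤t+β = cancelAfter 2 (o₂ b) A+2≤d
  ; B≤t'+β = cancelAfter 3 (o₃ b) B+3≤d
  ; 2+β≤t = n≤1+n _ ; 2+β≤t' = ≤-refl }
  where
  o₁ : ∀ b → (3 + b) + (2 + b) ≡ suc (2 * (2 + b))
  o₁ = solve-∀
  o₂ : ∀ b → suc (2 * (2 + b)) ≡ ((3 + b) + b) + 2
  o₂ = solve-∀
  o₃ : ∀ b → suc (2 * (2 + b)) ≡ ((2 + b) + b) + 3
  o₃ = solve-∀

balancedSplit : ∀ {A B d} → A + 2 ≤ d → B + 2 ≤ d → B + 3 ≤ d ⊎ 2 ∣ d → d ≤ A + B →
                Split A B d
balancedSplit A+2≤d B+2≤d parity d≤A+B =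
  splitHalves (halve _) (four≤ A+2≤d B+2≤d d≤A+B) A+2≤d B+2≤d parity

module Distance {n : ℕ} (G : Graph n) where

  V : Set
  V = Fin n

  D : V → V → ℕ → Set
  D = DistLE G

  D-refl : ∀ {u} k → D u u k
  D-refl k = 0 , z≤n , []

  D-mono : ∀ {u v k l} → D u v k → k ≤ l → D u v l
  D-mono (m , m≤k , p) k≤l = m , ≤-trans m≤k k≤l , p

  _++ʷ_ : ∀ {u w v i j} → Walk G u w i → Walk G w v j → Walk G u v (i + j)
  [] ++ʷ q = q
  (a ∷ p) ++ʷ q = a ∷ (p ++ʷ q)

  D-trans : ∀ {u w v i j} → D u w i → D w v j → D u v (i + j)
  D-trans (m , m≤i , p) (m' , m'≤j , q) = m + m' , +-mono-≤ m≤i m'≤j , p ++ʷ q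

  reverse : ∀ {u v k} → Walk G u v k → Walk G v u k
  reverse [] = []
  reverse (a ∷ p) = subst (Walk G _ _) (+-comm _ 1) (reverse p ++ʷ (Adj-sym G a ∷ []))

  D-sym : ∀ {u v k} → D u v k → D v u k
  D-sym (m , m≤k , p) = m , m≤k , reverse p

  Dist-sym : ∀ {u v k} → Dist G u v k → Dist G v u k
  Dist-sym (uv , minimal) = D-sym uv , λ m vu → minimal m (D-sym vu)

  D0 : ∀ {u v} → D u v 0 → u ≡ v
  D0 (zero , _ , []) = refl

  Adj→D1 : ∀ {u v} → Adj G u v → D u v 1
  Adj→D1 a = 1 , ≤-refl , a ∷ []

  adjacent : ∀ {u v} → D u v 1 → u ≢ v → Adj G u v
  adjacent (zero , _ , []) u≢v = ⊥-elim (u≢v refl)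
  adjacent (suc zero , _ , a ∷ []) _ = a
  adjacent (suc (suc _) , s≤s () , _) _

  splitWalk : ∀ {u v} i {j} → Walk G u v (i + j) → ∃ λ z → Walk G u z i × Walk G z v j
  splitWalk zero p = _ , [] , p
  splitWalk (suc i) (a ∷ p) with splitWalk i p
  ... | z , p₁ , p₂ = z , a ∷ p₁ , p₂

  D-split : ∀ {u v} i j → D u v (i + j) → ∃ λ z → D u z i × D z v j
  D-split {v = v} i j (m , m≤i+j , p) with m ≤? i
  ... | yes m≤i = v , (m , m≤i , p) , D-refl j
  ... | no m≰i with m≤n⇒∃[o]m+o≡n (<⇒≤ (≰⇒> m≰i))
  ... | j' , refl with splitWalk i p
  ... | z , p₁ , p₂ = z , (i , ≤-refl , p₁) , (j' , +-cancelˡ-≤ i _ _ m≤i+j , p₂)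

  walk? : ∀ u v k → Dec (Walk G u v k)
  walk? u v zero with u ≟F v
  ... | yes refl = yes []
  ... | no u≢v = no λ { [] → u≢v refl }
  walk? u v (suc k) with any? (λ w → step w)
    where
    step : ∀ w → Dec (Adj G u w × Walk G w v k)
    step w with Adj-dec G u w | walk? w v k
    ... | yes a | yes p = yes (a , p)
    ... | no ¬a | _ = no (¬a ∘ proj₁)
    ... | yes _ | no ¬p = no (¬p ∘ proj₂)
  ... | yes (w , a , p) = yes (a ∷ p)
  ... | no ¬step = no λ { (a ∷ p) → ¬step (_ , a , p) }

  D? : ∀ u v k → Dec (D u v k)
  D? u v zero with walk? u v zero
  ... | yes p = yes (0 , z≤n , p)
  ... | no ¬p = no λ { (zero , _ , p) → ¬p p }
  D? u v (suc k) with D? u v k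
  ... | yes uv = yes (D-mono uv (n≤1+n k))
  ... | no ¬uv with walk? u v (suc k)
  ... | yes p = yes (suc k , ≤-refl , p)
  ... | no ¬p = no λ { (m , m≤1+k , p) → shorter m m≤1+k p }
    where
    shorter : ∀ m → m ≤ suc k → Walk G u v m → ⊥
    shorter m m≤1+k p with m≤n⇒m<n∨m≡n m≤1+k
    ... | inj₁ m<1+k = ¬uv (m , ≤-pred m<1+k , p)
    ... | inj₂ refl = ¬p p

  hellyD : Helly G → ∀ m (c : Fin m → V) (ρ : Fin m → ℕ) →
           (∀ i j → D (c i) (c j) (ρ i + ρ j)) → ∃ λ z → ∀ i → D z (c i) (ρ i)
  hellyD H m c ρ close = H m c ρ meet
    where
    meet : ∀ i j → ∃ λ u → InBall G (ρ i) (c i) u × InBall G (ρ j) (c j) u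
    meet i j with D-split (ρ i) (ρ j) (close i j)
    ... | z , cz , zc = z , D-sym cz , zc

  helly4 : Helly G → ∀ {a b c e i j k l} →
           D a b (i + j) → D a c (i + k) → D a e (i + l) →
           D b c (j + k) → D b e (j + l) → D c e (k + l) →
           ∃ λ z → D z a i × D z b j × D z c k × D z e l
  helly4 H {a} {b} {c} {e} {i} {j} {k} {l} ab ac ae bc be ce with hellyD H 4 centre ρ close
    where
    centre : Fin 4 → V
    centre fz = a
    centre (fs fz) = b
    centre (fs (fs fz)) = c
    centre (fs (fs (fs fz))) = e
    ρ : Fin 4 → ℕ
    ρ fz = i
    ρ (fs fz) = j
    ρ (fs (fs fz)) = k
    ρ (fs (fs (fs fz))) = l
    flip : ∀ {u w} p q → D u w (p + q) → D w u (q + p)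
    flip p q uw = subst (D _ _) (+-comm p q) (D-sym uw)
    close : ∀ p q → D (centre p) (centre q) (ρ p + ρ q)
    close fz fz = D-refl _
    close fz (fs fz) = ab
    close fz (fs (fs fz)) = ac
    close fz (fs (fs (fs fz))) = ae
    close (fs fz) fz = flip i j ab
    close (fs fz) (fs fz) = D-refl _
    close (fs fz) (fs (fs fz)) = bc
    close (fs fz) (fs (fs (fs fz))) = be
    close (fs (fs fz)) fz = flip i k ac
    close (fs (fs fz)) (fs fz) = flip j k bc
    close (fs (fs fz)) (fs (fs fz)) = D-refl _
    close (fs (fs fz)) (fs (fs (fs fz))) = ce
    close (fs (fs (fs fz))) fz = flip i l ae
    close (fs (fs (fs fz))) (fs fz) = flip j l be
    close (fs (fs (fs fz))) (fs (fs fz)) = flip k l ce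
    close (fs (fs (fs fz))) (fs (fs (fs fz))) = D-refl _
  ... | z , z∈ = z , z∈ fz , z∈ (fs fz) , z∈ (fs (fs fz)) , z∈ (fs (fs (fs fz)))

  helly3 : Helly G → ∀ {a b c i j k} → D a b (i + j) → D a c (i + k) → D b c (j + k) →
           ∃ λ z → D z a i × D z b j × D z c k
  helly3 H ab ac bc with helly4 H ab ac ac bc bc (D-refl _)
  ... | z , za , zb , zc , _ = z , za , zb , zc

  eccentricity : ∀ u B → (∀ w → D w u B) → ∃ λ K → K ≤ B × Ecc G u K
  eccentricity u zero all = 0 , z≤n , all , u , (D-refl 0 , λ _ _ → z≤n)
  eccentricity u (suc B) all with all? (λ w → D? w u B)
  ... | yes allB with eccentricity u B allB
  ...   | K , K≤B , eccK = K , m≤n⇒m≤1+n K≤B , eccK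
  eccentricity u (suc B) all | no ¬allB with ¬∀⟶∃¬ n (λ w → D w u B) (λ w → D? w u B) ¬allB
  ... | w , ¬wu = suc B , ≤-refl , all , w , (all w , exact)
    where
    exact : ∀ m → D w u m → suc B ≤ m
    exact m wu with suc B ≤? m
    ... | yes B<m = B<m
    ... | no B≮m = ⊥-elim (¬wu (D-mono wu (≤-pred (≰⇒> B≮m))))

module _ {n : ℕ} {G : Graph n} where
  open Distance G

  diameter≤2radius : ∀ {d r} → Radius G r → Diameter G d → d ≤ 2 * r
  diameter≤2radius {r = r} ((_ , c-ecc , _) , _) ((_ , _ , _ , (_ , minimal)) , _) =
    minimal (2 * r) (subst (D _ _) (double r) (D-trans (c-ecc _) (D-sym (c-ecc _))))

  withinDiameter : ∀ {d r} → Radius G r → Diameter G d → ∀ u w → D w u d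
  withinDiameter {r = r} ((_ , c-ecc , _) , _) (_ , maximal) u w
    with eccentricity u (r + r) (λ w → D-trans (c-ecc w) (D-sym (c-ecc u)))
  ... | K , _ , u-ecc = D-mono (proj₁ u-ecc w) (maximal u K u-ecc)

  -- In a Helly graph the radius is at most ⌈d/2⌉: the balls of radius
  -- ⌈d/2⌉ around all vertices pairwise intersect.
  2radius≤diameter+1 : ∀ {d r} → Helly G → Radius G r → Diameter G d → 2 * r ≤ suc d
  2radius≤diameter+1 {d} {r} H rad dia with ceilHalf d
  ... | h , d≤2h , 2h≤1+d
    with hellyD H n id (λ _ → h)
           (λ i j → D-mono (withinDiameter rad dia j i) (≤-trans d≤2h (≤-reflexive (sym (double h)))))
  ... | z , z-central with eccentricity z h (λ w → D-sym (z-central w))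
  ... | K , K≤h , z-ecc = ≤-trans (*-monoʳ-≤ 2 (≤-trans (proj₂ rad z K z-ecc) K≤h)) 2h≤1+d

  oddDiameter : ∀ {d r} → Helly G → Radius G r → Diameter G d → ¬ 2 ∣ d → suc d ≡ 2 * r
  oddDiameter {r = r} H rad dia odd = ≤-antisym
    (≤∧≢⇒< (diameter≤2radius rad dia) (λ d≡2r → odd (subst (2 ∣_) (sym d≡2r) (even∣ r))))
    (2radius≤diameter+1 H rad dia)

module Slices {n : ℕ} {G : Graph n} (H : Helly G) (C4 : C4Free G)
              {x y : Fin n} {d : ℕ} (xy : Dist G x y d) where
  open Distance G

  Slice : ℕ → ℕ → V → Set
  Slice t t' z = D x z t × D z y t'

  noShortcut : ∀ {a i j} → D x a i → D a y j → i + j < d → ⊥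
  noShortcut xa ay i+j<d = <⇒≱ i+j<d (proj₂ xy _ (D-trans xa ay))

  shift : ∀ {a b} m → D a b (suc m) → D a b (m + 1)
  shift m = subst (D _ _) (+-comm 1 m)

  -- Two slice vertices at distance exactly 2, together with their common
  -- neighbours p (nearer x) and q (nearer y) given by Helly, span an induced C4.
  noDistanceTwo : ∀ t t' → t + t' ≡ d → ∀ {z u} → Slice t t' z → Slice t t' u →
                  D z u 2 → ¬ D z u 1 → ⊥
  noDistanceTwo zero _ _ (xz , _) (xu , _) _ zu≰1 with D0 xz | D0 xu
  ... | refl | refl = zu≰1 (D-refl 1)
  noDistanceTwo (suc _) zero _ (_ , zy) (_ , uy) _ zu≰1 with D0 zy | D0 uy
  ... | refl | refl = zu≰1 (D-refl 1)
  noDistanceTwo (suc t₀) (suc t₁) eq {z} {u} (xz , zy) (xu , uy) zu≤2 zu≰1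
    with helly3 H {x} {z} {u} {t₀} {1} {1} (shift t₀ xz) (shift t₀ xu) zu≤2
       | helly3 H {y} {z} {u} {t₁} {1} {1} (shift t₁ (D-sym zy)) (shift t₁ (D-sym uy)) zu≤2
  ... | p , px , pz , pu | q , qy , qz , qu =
    C4 z p u q (adjacent (D-sym pz) z≢p) (adjacent pu p≢u) (adjacent (D-sym qu) u≢q)
       (adjacent qz q≢z) z≢u p≢q (zu≰1 ∘ Adj→D1) (pq≰1 ∘ Adj→D1)
    where
    -- p is within t₀ of x, so no vertex within t₁ + 1 of y equals p.
    p-far : ∀ {w} → D w y (suc t₁) → p ≢ w
    p-far wy refl = noShortcut (D-sym px) wy (≤-reflexive eq)
    q-far : ∀ {w} → D x w (suc t₀) → q ≢ w
    q-far xw refl = noShortcut xw qy (≤-reflexive (trans (cong suc (sym (+-suc t₀ t₁))) eq))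
    pq≰1 : ¬ D p q 1
    pq≰1 pq = noShortcut (D-trans (D-sym px) pq) qy
                         (≤-reflexive (trans (cong suc (+-assoc t₀ 1 t₁)) eq))
    z≢p : z ≢ p
    z≢p = p-far zy ∘ sym
    p≢u : p ≢ u
    p≢u = p-far uy
    u≢q : u ≢ q
    u≢q = q-far xu ∘ sym
    q≢z : q ≢ z
    q≢z = q-far xz
    z≢u : z ≢ u
    z≢u refl = zu≰1 (D-refl 1)
    p≢q : p ≢ q
    p≢q refl = pq≰1 (D-refl 1)

  module _ (t t' : ℕ) (t+t'≡d : t + t' ≡ d) where

    xy' : D x y (t + t')
    xy' = subst (D x y) (sym t+t'≡d) (proj₁ xy)

    -- Decidability turns the exclusion of distance 2 into adjacency.
    within2⇒within1 : ∀ {z u} → Slice t t' z → Slice t t' u → D z u 2 → D z u 1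
    within2⇒within1 {z} {u} sz su zu≤2 with D? z u 1
    ... | yes zu≤1 = zu≤1
    ... | no zu≰1 = ⊥-elim (noDistanceTwo t t' t+t'≡d sz su zu≤2 zu≰1)

    -- Reducing the distance: a Helly point u within 2 of z, within M of w and
    -- in the slice is equal or adjacent to z, so z—w has length at most M + 1.
    cliqueStep : ∀ M → (∀ {z w} → Slice t t' z → Slice t t' w → D z w (suc M) → D z w 1) →
                 ∀ {z w} → Slice t t' z → Slice t t' w → D z w (2 + M) → D z w 1
    cliqueStep M shorter {z} {w} (xz , zy) (xw , wy) zw =
      viaHellyPoint (helly4 H {i = 2} {M} {t} {t'} zw
                       (D-mono (D-sym xz) (m≤n+m t 2)) (D-mono zy (m≤n+m t' 2))
                       (D-mono (D-sym xw) (m≤n+m t M)) (D-mono wy (m≤n+m t' M)) xy')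
      where
      viaHellyPoint : (∃ λ u → D u z 2 × D u w M × D u x t × D u y t') → D z w 1
      viaHellyPoint (u , uz , uw , ux , uy) =
        shorter (xz , zy) (xw , wy)
          (D-trans (within2⇒within1 (xz , zy) (D-sym ux , uy) (D-sym uz)) uw)

    cliqueUpTo : ∀ M {z w} → Slice t t' z → Slice t t' w → D z w M → D z w 1
    cliqueUpTo zero _ _ zw = D-mono zw z≤n
    cliqueUpTo (suc zero) _ _ zw = zw
    cliqueUpTo (suc (suc M)) = cliqueStep M (cliqueUpTo (suc M))

    sliceClique : ∀ {z w} → Slice t t' z → Slice t t' w → D z w 1
    sliceClique sz sw = cliqueUpTo (t + t) sz sw (D-trans (D-sym (proj₁ sz)) (proj₁ sw))

    median : ∀ {p β} → D p x (t + β) → D p y (t' + β) → ∃ λ m → Slice t t' m × D p m β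
    median {p} {β} px py with helly3 H {x} {y} {p} {t} {t'} {β} xy' (D-sym px) (D-sym py)
    ... | m , mx , my , mp = m , (D-sym mx , my) , D-sym mp

module _ {n : ℕ} {G : Graph n} (H : Helly G) (C4 : C4Free G) where
  open Distance G

  shortcutToFarVertex : ∀ {x y d s v k A B} → Dist G x y d → D s x k → D s y k →
                        Split A B d → D v x A → D v y B → ∃ λ m → m < k × D s v m
  shortcutToFarVertex {d = d} {s} {v} {k} xy sx sy split vx vy =
    join (median t t' t+t'≡d (D-mono sx (slack (m⊓n≤m t t'))) (D-mono sy (slack (m⊓n≤n t t'))))
         (median t t' t+t'≡d (D-mono vx A≤t+β) (D-mono vy B≤t'+β))
    where
    open Split split
    open Slices H C4 xy
    -- s projects onto the slice within k - m₀, where m₀ = min(t,t') ≤ k,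
    -- v within β, and the two projections are adjacent.
    m₀ : ℕ
    m₀ = t ⊓ t'
    m₀≤k : m₀ ≤ k
    m₀≤k = *-cancelˡ-≤ 2 (begin
      2 * m₀   ≡⟨ double m₀ ⟨
      m₀ + m₀  ≤⟨ +-mono-≤ (m⊓n≤m t t') (m⊓n≤n t t') ⟩
      t + t'   ≡⟨ t+t'≡d ⟩
      d        ≤⟨ proj₂ xy (k + k) (D-trans (D-sym sx) sy) ⟩
      k + k    ≡⟨ double k ⟩
      2 * k    ∎)
      where open ≤-Reasoning
    slack : ∀ {u} → m₀ ≤ u → k ≤ u + (k ∸ m₀)
    slack m₀≤u = ≤-trans (m≤n+m∸n k m₀) (+-monoˡ-≤ (k ∸ m₀) m₀≤u)
    shorter : (k ∸ m₀) + (1 + β) < k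
    shorter = subst ((k ∸ m₀) + (1 + β) <_) (m∸n+n≡m m₀≤k)
                    (+-monoʳ-< (k ∸ m₀) (⊓-glb 2+β≤t 2+β≤t'))
    join : (∃ λ a → Slice t t' a × D s a (k ∸ m₀)) → (∃ λ b → Slice t t' b × D v b β) →
           ∃ λ m → m < k × D s v m
    join (a , Sa , sa) (b , Sb , vb) =
      _ , shorter , D-trans sa (D-trans (sliceClique t t' t+t'≡d Sa Sb) (D-sym vb))

module FarthestVertex {n : ℕ} {G : Graph n} (H : Helly G) (C4 : C4Free G)
                      {s v : Fin n} {k d : ℕ}
                      (s-ecc : ∀ u → DistLE G u s k) (v-far : ∀ m → DistLE G s v m → k ≤ m) where
  open Distance G

  excluded : ∀ {x y A B} → Dist G x y d → D v x A → D v y B →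
             A + 2 ≤ d → B + 2 ≤ d → B + 3 ≤ d ⊎ 2 ∣ d → ⊥
  excluded xy vx vy A+2≤d B+2≤d parity =
    contradict (shortcutToFarVertex H C4 xy (D-sym (s-ecc _)) (D-sym (s-ecc _))
                  (balancedSplit A+2≤d B+2≤d parity (proj₂ xy _ (D-trans (D-sym vx) vy))) vx vy)
    where
    contradict : (∃ λ m → m < k × D s v m) → ⊥
    contradict (m , m<k , sv) = <⇒≱ m<k (v-far m sv)

  module _ {x y e} (xy : Dist G x y d) (v-ecc : ∀ u → D u v e) where

    eccLower : d ≤ e + 2
    eccLower with d ≤? e + 2
    ... | yes d≤e+2 = d≤e+2
    ... | no d≰e+2 = ⊥-elim (excluded xy (D-sym (v-ecc x)) (D-sym (v-ecc y))
                               (+3⇒+2 e+3≤d) (+3⇒+2 e+3≤d) (inj₁ e+3≤d))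
      where
      e+3≤d : e + 3 ≤ d
      e+3≤d = subst (_≤ d) (sym (+-suc e 2)) (≰⇒> d≰e+2)

    module Tight (e+2≡d : e + 2 ≡ d) where

      oddDiam : ¬ 2 ∣ d
      oddDiam 2∣d = excluded xy (D-sym (v-ecc x)) (D-sym (v-ecc y))
                      (≤-reflexive e+2≡d) (≤-reflexive e+2≡d) (inj₂ 2∣d)

      exactEnd : ∀ {X Y} → Dist G X Y d → Dist G v X e
      exactEnd {X} {Y} XY = D-sym (v-ecc X) , atLeast
        where
        atLeast : ∀ m → D v X m → e ≤ m
        atLeast m vX with e ≤? m
        ... | yes e≤m = e≤m
        ... | no e≰m = ⊥-elim (excluded (Dist-sym XY) (D-sym (v-ecc Y)) vX
                                 (≤-reflexive e+2≡d) (+3⇒+2 m+3≤d) (inj₁ m+3≤d))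
          where
          m+3≤d : m + 3 ≤ d
          m+3≤d = subst (_≤ d) (sym (+-suc m 2)) (subst (suc m + 2 ≤_) e+2≡d (+-monoˡ-≤ 2 (≰⇒> e≰m)))

lemma9 : ∀ {n : ℕ} (G : Graph n) → Connected G → Helly G → C4Free G →
    ∀ (d r : ℕ) → Diameter G d → Radius G r →
    ∀ (s v : Fin n) (es : ℕ) → Ecc G s es → Dist G s v es →
    ∀ (x y : Fin n) → Dist G x y d →
    ∀ (ev : ℕ) → Ecc G v ev →
    (d ≤ ev + 2)
    × (ev + 2 ≡ d →
    (ev + 3 ≡ 2 * r) × Dist G v x ev × Dist G v y ev × (d + 1 ≡ 2 * r))
    × (2 ∣ ev → d ≤ ev + 1)
lemma9 G _ H C4 d r dia rad s v es eccS dsv x y dxy ev eccV =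
  eccLower dxy (proj₁ eccV) , tight , evenEcc
  where
  open Distance G using (Dist-sym)
  open FarthestVertex H C4 (proj₁ eccS) (proj₂ dsv)
  tight : ev + 2 ≡ d → (ev + 3 ≡ 2 * r) × Dist G v x ev × Dist G v y ev × (d + 1 ≡ 2 * r)
  tight e+2≡d = trans (sym (+-assoc ev 2 1)) (trans (cong (_+ 1) e+2≡d) d+1≡2r) ,
                exactEnd dxy , exactEnd (Dist-sym dxy) , d+1≡2r
    where
    open Tight dxy (proj₁ eccV) e+2≡d
    d+1≡2r : d + 1 ≡ 2 * r
    d+1≡2r = trans (+-comm d 1) (oddDiameter H rad dia oddDiam)
  evenEcc : 2 ∣ ev → d ≤ ev + 1
  evenEcc 2∣ev = ≤-pred (subst (d <_) (+-suc ev 1) (≤∧≢⇒< (eccLower dxy (proj₁ eccV)) d≢ev+2))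
    where
    d≢ev+2 : d ≢ ev + 2
    d≢ev+2 d≡ev+2 = Tight.oddDiam dxy (proj₁ eccV) (sym d≡ev+2)
                      (subst (2 ∣_) (sym d≡ev+2) (∣m∣n⇒∣m+n 2∣ev ∣-refl))
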